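{- Let $X_1,\ldots,X_n$ be $\{0,1\}$-valued random variables satisfying 1-negative association. Then they satisfy weak negative regression.
   Context: 1-negative association: for every index $i$, every monotone function $g$ of $X_i$ alone and every monotone function $f$ of $(X_j)_{j\ne i}$, monotone in the same direction (both non-decreasing or both non-increasing), $\mathbb{E}[fg]\le\mathbb{E}[f]\mathbb{E}[g]$. Weak negative regression: for every index $i$ and every non-decreasing function $f$ of $(X_j)_{j\ne i}$, $\mathbb{E}[f\mid X_i=b]\le\mathbb{E}[f\mid X_i=a]$ for all $a\le b$ among values taken by $X_i$ with positive probability. -}

module Defs where

open import Level using (Level; _⊔_) renaming (suc to lsuc)
open import Algebra.Bundles using (CommutativeRing)
open import Relation.Binary.Core using (Rel)
open import Relation.Binary.Structures using (IsTotalOrder)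
open import Relation.Nullary using (¬_; does)
open import Data.Bool using (Bool; true; false; if_then_else_) renaming (_≤_ to _≤ᵇ_)
import Data.Bool.Properties as BoolP
open import Data.Fin using (Fin; zero; suc)
open import Data.Nat using (ℕ)
open import Data.Product using (_×_; proj₂)
open import Data.Vec.Functional using (_∷_)
open import Relation.Binary.PropositionalEquality using (_≡_; _≢_)

record OrderedField (c ℓ₁ ℓ₂ : Level) : Set (lsuc (c ⊔ ℓ₁ ⊔ ℓ₂)) where
  field
    commutativeRing : CommutativeRing c ℓ₁
  open CommutativeRing commutativeRing public
  field
    _≤_          : Rel Carrier ℓ₂
    isTotalOrder : IsTotalOrder _≈_ _≤_
    +-mono-≤     : ∀ {a b} c → a ≤ b → (a + c) ≤ (b + c)
    *-nonneg     : ∀ {a b} → 0# ≤ a → 0# ≤ b → 0# ≤ (a * b)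
    0≉1          : ¬ (0# ≈ 1#)
    inv          : (a : Carrier) → ¬ (a ≈ 0#) → Carrier
    inv-r        : ∀ a (nz : ¬ (a ≈ 0#)) → (a * inv a nz) ≈ 1#

  Pos : Carrier → Set (ℓ₁ ⊔ ℓ₂)
  Pos a = (0# ≤ a) × ¬ (0# ≈ a)

  Pos⇒≉0 : ∀ {a} → Pos a → ¬ (a ≈ 0#)
  Pos⇒≉0 p e = proj₂ p (sym e)

-- Outcomes of n {0,1}-valued random variables: vectors x : Fin n → Bool
-- (false = 0, true = 1).  Coordinatewise order on outcomes:
_≤ᵛ_ : ∀ {n} → (Fin n → Bool) → (Fin n → Bool) → Set
x ≤ᵛ y = ∀ j → x j ≤ᵇ y j

module Prob {c ℓ₁ ℓ₂} (F : OrderedField c ℓ₁ ℓ₂) where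
  open OrderedField F

  sumAll : ∀ {n} → ((Fin n → Bool) → Carrier) → Carrier
  sumAll {ℕ.zero}  h = h (λ ())
  sumAll {ℕ.suc n} h = sumAll (λ x → h (false ∷ x)) + sumAll (λ x → h (true ∷ x))

  -- a probability mass function on {0,1}^n (joint law of X_1,…,X_n)
  IsDistribution : ∀ {n} → ((Fin n → Bool) → Carrier) → Set (ℓ₁ ⊔ ℓ₂)
  IsDistribution p = (∀ x → 0# ≤ p x) × (sumAll p ≈ 1#)

  𝔼 : ∀ {n} → ((Fin n → Bool) → Carrier) → ((Fin n → Bool) → Carrier) → Carrier
  𝔼 p h = sumAll (λ x → p x * h x)

  ind : ∀ {n} → Fin n → Bool → (Fin n → Bool) → Carrier
  ind i b x = if does (x i BoolP.≟ b) then 1# else 0#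

  Pr : ∀ {n} → ((Fin n → Bool) → Carrier) → Fin n → Bool → Carrier
  Pr p i b = 𝔼 p (ind i b)

  condE : ∀ {n} (p : (Fin n → Bool) → Carrier) → ((Fin n → Bool) → Carrier) →
             (i : Fin n) → (b : Bool) → Pos (Pr p i b) → Carrier
  condE p f i b pos =
    𝔼 p (λ x → f x * ind i b x) * inv (Pr p i b) (Pos⇒≉0 pos)

  IgnoresCoord : ∀ {n} → Fin n → ((Fin n → Bool) → Carrier) → Set (ℓ₁)
  IgnoresCoord i f = ∀ x y → (∀ j → j ≢ i → x j ≡ y j) → f x ≈ f y

  NonDecreasing : ∀ {n} → ((Fin n → Bool) → Carrier) → Set ℓ₂
  NonDecreasing f = ∀ {x y} → x ≤ᵛ y → f x ≤ f y

  NonIncreasing : ∀ {n} → ((Fin n → Bool) → Carrier) → Set ℓ₂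
  NonIncreasing f = ∀ {x y} → x ≤ᵛ y → f y ≤ f x

  NonDecreasing₁ : (Bool → Carrier) → Set ℓ₂
  NonDecreasing₁ g = ∀ {a b} → a ≤ᵇ b → g a ≤ g b

  NonIncreasing₁ : (Bool → Carrier) → Set ℓ₂
  NonIncreasing₁ g = ∀ {a b} → a ≤ᵇ b → g b ≤ g a

  OneNA : ∀ {n} → ((Fin n → Bool) → Carrier) → Set (c ⊔ ℓ₁ ⊔ ℓ₂)
  OneNA {n} p = ∀ (i : Fin n) (f : (Fin n → Bool) → Carrier) (g : Bool → Carrier) →
    IgnoresCoord i f →
    ((NonDecreasing f × NonDecreasing₁ g) ⊎' (NonIncreasing f × NonIncreasing₁ g)) →
    𝔼 p (λ x → f x * g (x i)) ≤ (𝔼 p f * 𝔼 p (λ x → g (x i)))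
    where open import Data.Sum using () renaming (_⊎_ to _⊎'_)

  WNR : ∀ {n} → ((Fin n → Bool) → Carrier) → Set (c ⊔ ℓ₁ ⊔ ℓ₂)
  WNR {n} p = ∀ (i : Fin n) (f : (Fin n → Bool) → Carrier) →
    IgnoresCoord i f → NonDecreasing f →
    ∀ {a b : Bool} → a ≤ᵇ b →
    (pa : Pos (Pr p i a)) (pb : Pos (Pr p i b)) →
    condE p f i b pb ≤ condE p f i a pa

-- Take for g the indicator of {Xᵢ = 1}.  Since f ignores Xᵢ, 1-negative
-- association gives E[f·1{Xᵢ=1}] ≤ E[f]·P(Xᵢ=1).  Splitting E[f] along Xᵢ
-- as A + B with A = E[f·1{Xᵢ=1}] and B = E[f·1{Xᵢ=0}], and using
-- P(Xᵢ=1) + P(Xᵢ=0) = 1, this reads A·P(Xᵢ=0) ≤ B·P(Xᵢ=1); dividing by both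
-- (positive) probabilities gives E[f | Xᵢ=1] ≤ E[f | Xᵢ=0].
module Submission where

open import Defs
open import Level using (Level)
open import Data.Nat using (ℕ)
open import Data.Fin using (Fin)
open import Data.Bool using (Bool; true; false; f≤t; b≤b) renaming (_≤_ to _≤ᵇ_)
open import Data.Empty using (⊥-elim)
open import Data.Product using (_,_; proj₁)
open import Data.Sum using (inj₁; inj₂)
open import Data.Vec.Functional using (_∷_)
open import Relation.Nullary using (¬_)
open import Relation.Binary.Bundles using (Poset)
open import Relation.Binary.Structures using (IsTotalOrder)
import Algebra.Properties.Ring as RingProperties
import Algebra.Properties.CommutativeSemigroup as CommutativeSemigroupProperties
import Relation.Binary.Reasoning.PartialOrder as PartialOrderReasoning

module OrderedFieldProperties {c ℓ₁ ℓ₂} (F : OrderedField c ℓ₁ ℓ₂) where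
  open OrderedField F
  open IsTotalOrder isTotalOrder using (total; antisym)
  open RingProperties ring using (-‿distribʳ-*; -1*x≈-x; -‿involutive; xyx⁻¹≈y; //-rightDividesˡ)
  open CommutativeSemigroupProperties *-commutativeSemigroup using (interchange; x∙yz≈yx∙z)

  poset : Poset c ℓ₁ ℓ₂
  poset = record { isPartialOrder = IsTotalOrder.isPartialOrder isTotalOrder }

  open PartialOrderReasoning poset

  ≤⇒0≤- : ∀ {a b} → a ≤ b → 0# ≤ (b + - a)
  ≤⇒0≤- {a} {b} a≤b = begin
    0#       ≈⟨ -‿inverseʳ a ⟨
    a + - a  ≤⟨ +-mono-≤ (- a) a≤b ⟩
    b + - a  ∎

  +-cancelˡ-≤ : ∀ c {a b} → (c + a) ≤ (c + b) → a ≤ b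
  +-cancelˡ-≤ c {a} {b} c+a≤c+b = begin
    a             ≈⟨ xyx⁻¹≈y c a ⟨
    c + a + - c   ≤⟨ +-mono-≤ (- c) c+a≤c+b ⟩
    c + b + - c   ≈⟨ xyx⁻¹≈y c b ⟩
    b             ∎

  *-monoˡ-≤-nonNeg : ∀ c {a b} → 0# ≤ c → a ≤ b → (a * c) ≤ (b * c)
  *-monoˡ-≤-nonNeg c {a} {b} 0≤c a≤b = begin
    a * c                  ≈⟨ +-identityˡ (a * c) ⟨
    0# + a * c             ≤⟨ +-mono-≤ (a * c) (*-nonneg (≤⇒0≤- a≤b) 0≤c) ⟩
    (b + - a) * c + a * c  ≈⟨ distribʳ c (b + - a) a ⟨
    (b + - a + a) * c      ≈⟨ *-congʳ (//-rightDividesˡ a b) ⟩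
    b * c                  ∎

  0≤1 : 0# ≤ 1#
  0≤1 with total 0# 1#
  ... | inj₁ 0≤1 = 0≤1
  ... | inj₂ 1≤0 = begin
    0#                         ≤⟨ *-nonneg (≤⇒0≤- 1≤0) (≤⇒0≤- 1≤0) ⟩
    (0# + - 1#) * (0# + - 1#)  ≈⟨ *-cong (+-identityˡ (- 1#)) (+-identityˡ (- 1#)) ⟩
    - 1# * - 1#                ≈⟨ -1*x≈-x (- 1#) ⟩
    - - 1#                     ≈⟨ -‿involutive 1# ⟩
    1#                         ∎

  inv-nonNeg : ∀ {a} → 0# ≤ a → (a≉0 : ¬ a ≈ 0#) → 0# ≤ inv a a≉0
  inv-nonNeg {a} 0≤a a≉0 with total 0# (inv a a≉0)
  ... | inj₁ 0≤a⁻¹ = 0≤a⁻¹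
  ... | inj₂ a⁻¹≤0 = ⊥-elim (0≉1 (antisym 0≤1 1≤0))
    where
    a⁻¹ = inv a a≉0
    -- a · (0 − a⁻¹) = −1 would be nonnegative.
    1≤0 : 1# ≤ 0#
    1≤0 = begin
      1#                      ≈⟨ +-identityˡ 1# ⟨
      0# + 1#                 ≤⟨ +-mono-≤ 1# (*-nonneg 0≤a (≤⇒0≤- a⁻¹≤0)) ⟩
      a * (0# + - a⁻¹) + 1#   ≈⟨ +-congʳ (*-congˡ (+-identityˡ (- a⁻¹))) ⟩
      a * - a⁻¹ + 1#          ≈⟨ +-congʳ (-‿distribʳ-* a a⁻¹) ⟨
      - (a * a⁻¹) + 1#        ≈⟨ +-congʳ (-‿cong (inv-r a a≉0)) ⟩
      - 1# + 1#               ≈⟨ -‿inverseˡ 1# ⟩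
      0#                      ∎

  inv-irrelevant : ∀ {a} (a≉0 a≉0′ : ¬ a ≈ 0#) → inv a a≉0 ≈ inv a a≉0′
  inv-irrelevant {a} a≉0 a≉0′ = begin-equality
    a⁻¹                 ≈⟨ *-identityʳ a⁻¹ ⟨
    a⁻¹ * 1#            ≈⟨ *-congˡ (inv-r a a≉0′) ⟨
    a⁻¹ * (a * a⁻¹′)    ≈⟨ x∙yz≈yx∙z a⁻¹ a a⁻¹′ ⟩
    (a * a⁻¹) * a⁻¹′    ≈⟨ *-congʳ (inv-r a a≉0) ⟩
    1# * a⁻¹′           ≈⟨ *-identityˡ a⁻¹′ ⟩
    a⁻¹′                ∎
    where
    a⁻¹  = inv a a≉0
    a⁻¹′ = inv a a≉0′

  cross-≤⇒div-≤ : ∀ {a b u v} (pu : Pos u) (pv : Pos v) → (a * v) ≤ (b * u) →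
                  (a * inv u (Pos⇒≉0 pu)) ≤ (b * inv v (Pos⇒≉0 pv))
  cross-≤⇒div-≤ {a} {b} {u} {v} pu pv av≤bu = begin
    a * u⁻¹                ≈⟨ *-identityʳ _ ⟨
    a * u⁻¹ * 1#           ≈⟨ *-congˡ (inv-r v (Pos⇒≉0 pv)) ⟨
    a * u⁻¹ * (v * v⁻¹)    ≈⟨ interchange a u⁻¹ v v⁻¹ ⟩
    a * v * (u⁻¹ * v⁻¹)    ≤⟨ *-monoˡ-≤-nonNeg (u⁻¹ * v⁻¹) 0≤u⁻¹v⁻¹ av≤bu ⟩
    b * u * (u⁻¹ * v⁻¹)    ≈⟨ *-congˡ (*-comm u⁻¹ v⁻¹) ⟩
    b * u * (v⁻¹ * u⁻¹)    ≈⟨ interchange b v⁻¹ u u⁻¹ ⟨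
    b * v⁻¹ * (u * u⁻¹)    ≈⟨ *-congˡ (inv-r u (Pos⇒≉0 pu)) ⟩
    b * v⁻¹ * 1#           ≈⟨ *-identityʳ _ ⟩
    b * v⁻¹                ∎
    where
    u⁻¹ = inv u (Pos⇒≉0 pu)
    v⁻¹ = inv v (Pos⇒≉0 pv)
    0≤u⁻¹v⁻¹ : 0# ≤ (u⁻¹ * v⁻¹)
    0≤u⁻¹v⁻¹ = *-nonneg (inv-nonNeg (proj₁ pu) _) (inv-nonNeg (proj₁ pv) _)

  share-≤⇒cross-≤ : ∀ {a b q r} → (q + r) ≈ 1# → a ≤ ((a + b) * q) → (a * r) ≤ (b * q)
  share-≤⇒cross-≤ {a} {b} {q} {r} q+r≈1 a≤[a+b]q = +-cancelˡ-≤ (a * q) (begin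
    a * q + a * r   ≈⟨ distribˡ a q r ⟨
    a * (q + r)     ≈⟨ *-congˡ q+r≈1 ⟩
    a * 1#          ≈⟨ *-identityʳ a ⟩
    a               ≤⟨ a≤[a+b]q ⟩
    (a + b) * q     ≈⟨ distribʳ q a b ⟩
    a * q + b * q   ∎)

module ExpectationProperties {c ℓ₁ ℓ₂} (F : OrderedField c ℓ₁ ℓ₂) where
  open OrderedField F
  open Prob F
  open OrderedFieldProperties F using (poset; 0≤1)
  open PartialOrderReasoning poset

  sumAll-cong : ∀ {n} {h k : (Fin n → Bool) → Carrier} → (∀ x → h x ≈ k x) → sumAll h ≈ sumAll k
  sumAll-cong {ℕ.zero}  h≈k = h≈k _
  sumAll-cong {ℕ.suc n} h≈k =
    +-cong (sumAll-cong λ x → h≈k (false ∷ x)) (sumAll-cong λ x → h≈k (true ∷ x))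

  sumAll-distrib-+ : ∀ {n} (h k : (Fin n → Bool) → Carrier) →
                     sumAll (λ x → h x + k x) ≈ (sumAll h + sumAll k)
  sumAll-distrib-+ {ℕ.zero}  h k = refl
  sumAll-distrib-+ {ℕ.suc n} h k =
    trans (+-cong (sumAll-distrib-+ (λ x → h (false ∷ x)) (λ x → k (false ∷ x)))
                  (sumAll-distrib-+ (λ x → h (true ∷ x)) (λ x → k (true ∷ x))))
          (interchange _ _ _ _)
    where open CommutativeSemigroupProperties +-commutativeSemigroup using (interchange)

  𝟙 : Bool → Carrier
  𝟙 false = 0#
  𝟙 true  = 1#

  ind-true≈𝟙 : ∀ {n} (i : Fin n) x → ind i true x ≈ 𝟙 (x i)
  ind-true≈𝟙 i x with x i
  ... | true  = refl
  ... | false = refl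

  ind-true+ind-false≈1 : ∀ {n} (i : Fin n) x → (ind i true x + ind i false x) ≈ 1#
  ind-true+ind-false≈1 i x with x i
  ... | true  = +-identityʳ 1#
  ... | false = +-identityˡ 1#

  𝟙-nonDecreasing : NonDecreasing₁ 𝟙
  𝟙-nonDecreasing f≤t = 0≤1
  𝟙-nonDecreasing b≤b = IsTotalOrder.refl isTotalOrder

  𝔼-split : ∀ {n} (p f : (Fin n → Bool) → Carrier) (i : Fin n) →
            𝔼 p f ≈ (𝔼 p (λ x → f x * ind i true x) + 𝔼 p (λ x → f x * ind i false x))
  𝔼-split p f i =
    trans (sumAll-cong split)
          (sumAll-distrib-+ (λ x → p x * (f x * ind i true x)) (λ x → p x * (f x * ind i false x)))
    where
    split : ∀ x → (p x * f x) ≈ (p x * (f x * ind i true x) + p x * (f x * ind i false x))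
    split x = begin-equality
      p x * f x
        ≈⟨ *-congˡ (*-identityʳ (f x)) ⟨
      p x * (f x * 1#)
        ≈⟨ *-congˡ (*-congˡ (ind-true+ind-false≈1 i x)) ⟨
      p x * (f x * (ind i true x + ind i false x))
        ≈⟨ *-congˡ (distribˡ (f x) _ _) ⟩
      p x * (f x * ind i true x + f x * ind i false x)
        ≈⟨ distribˡ (p x) _ _ ⟩
      p x * (f x * ind i true x) + p x * (f x * ind i false x)
        ∎

  Pr-true+Pr-false≈1 : ∀ {n} {p : (Fin n → Bool) → Carrier} → IsDistribution p → (i : Fin n) →
                       (Pr p i true + Pr p i false) ≈ 1#
  Pr-true+Pr-false≈1 {p = p} (_ , total≈1) i = begin-equality
    Pr p i true + Pr p i false
      ≈⟨ +-cong (drop-1 true) (drop-1 false) ⟨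
    𝔼 p (λ x → 1# * ind i true x) + 𝔼 p (λ x → 1# * ind i false x)
      ≈⟨ 𝔼-split p (λ _ → 1#) i ⟨
    𝔼 p (λ _ → 1#)
      ≈⟨ sumAll-cong (λ x → *-identityʳ (p x)) ⟩
    sumAll p
      ≈⟨ total≈1 ⟩
    1#
      ∎
    where
    drop-1 : ∀ b → 𝔼 p (λ x → 1# * ind i b x) ≈ Pr p i b
    drop-1 b = sumAll-cong (λ x → *-congˡ (*-identityˡ (ind i b x)))

  oneNA⇒share-≤ : ∀ {n} {p : (Fin n → Bool) → Carrier} → OneNA p →
                  ∀ i f → IgnoresCoord i f → NonDecreasing f →
                  𝔼 p (λ x → f x * ind i true x) ≤
                    ((𝔼 p (λ x → f x * ind i true x) + 𝔼 p (λ x → f x * ind i false x)) * Pr p i true)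
  oneNA⇒share-≤ {p = p} oneNA i f ignores nonDecreasing = begin
    𝔼 p (λ x → f x * ind i true x)
      ≈⟨ sumAll-cong (λ x → *-congˡ (*-congˡ (ind-true≈𝟙 i x))) ⟩
    𝔼 p (λ x → f x * 𝟙 (x i))
      ≤⟨ oneNA i f 𝟙 ignores (inj₁ (nonDecreasing , 𝟙-nonDecreasing)) ⟩
    𝔼 p f * 𝔼 p (λ x → 𝟙 (x i))
      ≈⟨ *-cong (𝔼-split p f i) (sym (sumAll-cong (λ x → *-congˡ (ind-true≈𝟙 i x)))) ⟩
    (𝔼 p (λ x → f x * ind i true x) + 𝔼 p (λ x → f x * ind i false x)) * Pr p i true
      ∎

claim2 : ∀ {c ℓ₁ ℓ₂ : Level} (F : OrderedField c ℓ₁ ℓ₂) (n : ℕ)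
           (p : (Fin n → Bool) → OrderedField.Carrier F) →
           Prob.IsDistribution F p → Prob.OneNA F p → Prob.WNR F p
claim2 F n p distribution oneNA i f ignores nonDecreasing = regression
  where
  open OrderedField F
  open Prob F
  open OrderedFieldProperties F
  open ExpectationProperties F

  regression : ∀ {a b} → a ≤ᵇ b → (pa : Pos (Pr p i a)) (pb : Pos (Pr p i b)) →
               condE p f i b pb ≤ condE p f i a pa
  regression b≤b pa pb = IsTotalOrder.reflexive isTotalOrder (*-congˡ (inv-irrelevant _ _))
  regression f≤t pa pb =
    cross-≤⇒div-≤ pb pa
      (share-≤⇒cross-≤ (Pr-true+Pr-false≈1 distribution i)
        (oneNA⇒share-≤ oneNA i f ignores nonDecreasing))
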